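{- (1) For every integer $d \ge 2$ and every integer $k \ge 1$ there exists a matrix $A: X \times Y \rightarrow \{0,1,\ldots,k\}$ such that $\mathrm{Pdim}(A) = d$, $\mathrm{Vdim}^*(A) = 2^d$ and $\mathrm{Pdim}^*(A) = k \cdot 2^d$. (2) For every integer $k \ge 1$ there exists a matrix $A: X \times Y \rightarrow \{0,1,\ldots,k\}$ such that $\mathrm{Vdim}(A) = \mathrm{Pdim}(A) = 1$ and $\mathrm{Pdim}^*(A) = k+2$.
   Context: A matrix is a function $A: X \times Y \rightarrow Z$ with $Z \subseteq \mathbb{R}$ (rows indexed by $X$, columns by $Y$). A set $J \subseteq Y$ is P-shattered by $A$ if there is $\vec t: J \rightarrow \mathbb{R}$ such that for every $b: J \rightarrow \{0,1\}$ there is $x \in X$ with, for all $y \in J$, $A(x,y) \ge \vec t(y)$ iff $b(y)=1$. $J$ is V-shattered by $A$ if the same holds with a single number $t \in \mathbb{R}$ used for all $y\in J$ in place of $\vec t(y)$. $\mathrm{Pdim}(A)$ (resp. $\mathrm{Vdim}(A)$) is the largest size of a P-shattered (resp. V-shattered) set $J\subseteq Y$, or $\infty$ if such sets of unbounded size exist. The transpose $A^\top: Y \times X \rightarrow Z$ is $A^\top(y,x) = A(x,y)$, and the dual dimensions are $\mathrm{Pdim}^*(A) := \mathrm{Pdim}(A^\top)$, $\mathrm{Vdim}^*(A) := \mathrm{Vdim}(A^\top)$. -}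

module Defs where

open import Data.Nat using (ℕ; zero; suc; _≤_)
open import Data.Integer using (+_)
open import Data.Rational using (ℚ; _/_) renaming (_≤_ to _≤ℚ_)
open import Data.Fin using (Fin; toℕ)
open import Data.Bool using (Bool; true)
open import Data.Product using (Σ; ∃; _×_; _,_)
open import Function.Definitions using (Injective)
open import Function.Bundles using (_⇔_)
open import Relation.Binary.PropositionalEquality using (_≡_)

-- A matrix with rows indexed by X, columns by Y, entries in {0,1,…,k}
-- (an element of Fin (suc k) is read as its value toℕ in {0,…,k}).
Matrix : Set → Set → ℕ → Set
Matrix X Y k = X → Y → Fin (suc k)

val : {k : ℕ} → Fin (suc k) → ℚ
val v = (+ toℕ v) / 1

_ᵀ : {X Y : Set} {k : ℕ} → Matrix X Y k → Matrix Y X k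
(A ᵀ) y x = A x y

-- A finite set J ⊆ Y of size n is given as an injective map Fin n → Y.
-- J is P-shattered: some threshold vector t works for every pattern b.
PShattered : {X Y : Set} {k : ℕ} → Matrix X Y k → (n : ℕ) → (Fin n → Y) → Set
PShattered {X} A n J =
  Σ (Fin n → ℚ) λ t → (b : Fin n → Bool) →
    Σ X λ x → (i : Fin n) → ((t i ≤ℚ val (A x (J i))) ⇔ (b i ≡ true))

VShattered : {X Y : Set} {k : ℕ} → Matrix X Y k → (n : ℕ) → (Fin n → Y) → Set
VShattered {X} A n J =
  Σ ℚ λ t → (b : Fin n → Bool) →
    Σ X λ x → (i : Fin n) → ((t ≤ℚ val (A x (J i))) ⇔ (b i ≡ true))

HasDim : {Y : Set} → ((n : ℕ) → (Fin n → Y) → Set) → ℕ → Set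
HasDim {Y} S d =
  (Σ (Fin d → Y) λ J → Injective _≡_ _≡_ J × S d J) ×
  ((n : ℕ) (J : Fin n → Y) → Injective _≡_ _≡_ J → S n J → n ≤ d)

Pdim≡ : {X Y : Set} {k : ℕ} → Matrix X Y k → ℕ → Set
Pdim≡ A d = HasDim (PShattered A) d

Vdim≡ : {X Y : Set} {k : ℕ} → Matrix X Y k → ℕ → Set
Vdim≡ A d = HasDim (VShattered A) d

Pdim*≡ : {X Y : Set} {k : ℕ} → Matrix X Y k → ℕ → Set
Pdim*≡ A d = Pdim≡ (A ᵀ) d

Vdim*≡ : {X Y : Set} {k : ℕ} → Matrix X Y k → ℕ → Set
Vdim*≡ A d = Vdim≡ (A ᵀ) d

{-# OPTIONS --safe #-}

-- Both matrices are level matrices: every row x has a level ℓ x < k, the columns are all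
-- Boolean functions g on the rows, and the entry at (x, g) is ℓ x + g x.  Every set of rows
-- is P*-shattered (row x by the threshold ℓ x + 1), so Pdim* is the number of rows, and a
-- set of rows is V*-shattered exactly when it lies in one level.  Dually, if a shattered set
-- of columns has patterns b, c with b i = 1 and c i = 0, the row realising c has level at
-- most that of the row realising b; hence all non-constant patterns are realised in a single
-- level.  For (1) the rows are the pairs (level, point of {0,1}^d): the coordinates are
-- shattered, and n shattered columns give 2^n - 2 distinct rows in a level of size 2^d.
-- For (2) there are k levels plus one extra row at the lowest and at the highest level; two
-- shattered columns would put the rows of 10 and 01 on a common level a, with the row of 00
-- below and that of 11 above, i.e. three distinct rows on a level of size at most two
-- (for k = 1: four rows among three).

module Submission where

open import Defs
open import Data.Nat using (ℕ; _≤_; _*_; _^_; _+_)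
open import Data.Product using (Σ; _×_)

open import Data.Nat using (zero; suc; _<_; z≤n; s≤s)
import Data.Nat.Properties as ℕP
open import Data.Integer as ℤ using (+_)
import Data.Integer.Properties as ℤP
open import Data.Rational using (ℚ; mkℚ; *≤*) renaming (_≤_ to _≤ℚ_)
import Data.Rational.Properties as ℚP
open import Data.Nat.Coprimality using (1-coprimeTo) renaming (sym to coprime-sym)
open import Data.Fin as Fin using (Fin; toℕ; inject₁; fromℕ; finToFun; funToFin; combine)
open import Data.Fin.Patterns using (0F; 1F)
import Data.Fin.Properties as FinP
open import Data.Bool using (Bool; true; false; not)
import Data.Bool.Properties as BoolP
open import Data.Product using (proj₁; proj₂; _,_; ∃; map₂)
open import Data.Product.Properties using (,-injectiveʳ; ×-≡,≡→≡)
open import Data.Sum using (_⊎_; inj₁; inj₂; [_,_]′)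
open import Data.Sum.Properties using (inj₁-injective; inj₂-injective)
open import Data.Sum.Function.Propositional using (_⊎-↔_)
open import Data.Empty using (⊥; ⊥-elim)
open import Function using (_∘_; const; _↔_; Inverse)
open import Function.Bundles using (_⇔_; mk⇔; Equivalence)
open import Function.Definitions using (Injective)
open import Function.Properties.Inverse using (↔-refl; ↔-trans)
open import Relation.Nullary using (¬_; yes; no; does; contradiction)
open import Relation.Nullary.Decidable using (dec-true; proof)
open import Relation.Nullary.Reflects using (Reflects; invert)
open import Relation.Binary.PropositionalEquality

val≡mkℚ : ∀ {k} (v : Fin (suc k)) → val v ≡ mkℚ (+ toℕ v) 0 (coprime-sym (1-coprimeTo (toℕ v)))
val≡mkℚ v = ℚP.normalize-coprime _

val-mono : ∀ {k} {u v : Fin (suc k)} → u Fin.≤ v → val u ≤ℚ val v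
val-mono {u = u} {v} u≤v rewrite val≡mkℚ u | val≡mkℚ v =
  *≤* (subst₂ ℤ._≤_ (sym (ℤP.*-identityʳ _)) (sym (ℤP.*-identityʳ _)) (ℤ.+≤+ u≤v))

val-cancel : ∀ {k} {u v : Fin (suc k)} → val u ≤ℚ val v → u Fin.≤ v
val-cancel {u = u} {v} u≤v rewrite val≡mkℚ u | val≡mkℚ v with u≤v
... | *≤* u*1≤v*1 = ℤP.drop‿+≤+ (subst₂ ℤ._≤_ (ℤP.*-identityʳ _) (ℤP.*-identityʳ _) u*1≤v*1)

threshold-separates : ∀ {k} {t : ℚ} {u v : Fin (suc k)} → t ≤ℚ val u → ¬ t ≤ℚ val v → v Fin.< u
threshold-separates {u = u} {v} t≤u t≰v with u FinP.≤? v
... | yes u≤v = contradiction (ℚP.≤-trans t≤u (val-mono u≤v)) t≰v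
... | no u≰v = ℕP.≰⇒> u≰v

entry : ∀ {k} → Fin k → Bool → Fin (suc k)
entry j false = inject₁ j
entry j true = Fin.suc j

levelMatrix : {X : Set} {k : ℕ} → (X → Fin k) → Matrix X (X → Bool) k
levelMatrix ℓ x g = entry (ℓ x) (g x)

level≤entry : ∀ {k} (j : Fin k) β → toℕ j ≤ toℕ (entry j β)
level≤entry j false = ℕP.≤-reflexive (sym (FinP.toℕ-inject₁ j))
level≤entry j true = ℕP.n≤1+n (toℕ j)

entry≤suc-level : ∀ {k} (j : Fin k) β → toℕ (entry j β) ≤ suc (toℕ j)
entry≤suc-level j false = ℕP.≤-trans (ℕP.≤-reflexive (FinP.toℕ-inject₁ j)) (ℕP.n≤1+n (toℕ j))
entry≤suc-level j true = ℕP.≤-refl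

entry-<⇒level-≤ : ∀ {k} {j j' : Fin k} {β β'} → entry j' β' Fin.< entry j β → j' Fin.≤ j
entry-<⇒level-≤ {j = j} {j'} {β} {β'} e'<e =
  ℕP.≤-pred (ℕP.≤-trans (s≤s (level≤entry j' β')) (ℕP.≤-trans e'<e (entry≤suc-level j β)))

entry-threshold : ∀ {k} (j : Fin k) β → (val (entry j true) ≤ℚ val (entry j β)) ⇔ (β ≡ true)
entry-threshold j true = mk⇔ (const refl) (const ℚP.≤-refl)
entry-threshold j false =
  mk⇔ (λ le → contradiction (ℕP.≤-reflexive (FinP.toℕ-inject₁ j)) (ℕP.<⇒≱ (val-cancel le))) λ ()

⇔-true-unique : ∀ {P : Set} {b c : Bool} → P ⇔ (b ≡ true) → P ⇔ (c ≡ true) → b ≡ c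
⇔-true-unique {b = true} {true} _ _ = refl
⇔-true-unique {b = true} {false} P⇔b P⇔c = sym (Equivalence.to P⇔c (Equivalence.from P⇔b refl))
⇔-true-unique {b = false} {true} P⇔b P⇔c = Equivalence.to P⇔b (Equivalence.from P⇔c refl)
⇔-true-unique {b = false} {false} _ _ = refl

V⇒P : ∀ {X Y : Set} {k n} {A : Matrix X Y k} {J : Fin n → Y} → VShattered A n J → PShattered A n J
V⇒P (t , realise) = const t , realise

retraction⇒injective : ∀ {A B : Set} {f : A → B} (g : B → A) → (∀ x → g (f x) ≡ x) → Injective _≡_ _≡_ f
retraction⇒injective g gf {x} {y} fx≡fy = trans (sym (gf x)) (trans (cong g fx≡fy) (gf y))

injective⇒≤-via : ∀ {B : Set} {m n} → Fin n ↔ B → {f : Fin m → B} → Injective _≡_ _≡_ f → m ≤ n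
injective⇒≤-via e f-inj =
  FinP.injective⇒≤ (f-inj ∘ retraction⇒injective (Inverse.to e) (Inverse.strictlyInverseˡ e))

-- Boolean patterns coded by Fin (2 ^ n)

bits : ∀ {n} → Fin (2 ^ n) → Fin n → Bool
bits c = Inverse.to FinP.2↔Bool ∘ finToFun c

fromBits : ∀ {n} → (Fin n → Bool) → Fin (2 ^ n)
fromBits b = funToFin (Inverse.from FinP.2↔Bool ∘ b)

funToFin-cong : ∀ {m n} {f g : Fin m → Fin n} → (∀ i → f i ≡ g i) → funToFin f ≡ funToFin g
funToFin-cong {zero} _ = refl
funToFin-cong {suc m} f≗g = cong₂ combine (f≗g 0F) (funToFin-cong (f≗g ∘ Fin.suc))

bits-fromBits : ∀ {n} (b : Fin n → Bool) i → bits {n} (fromBits b) i ≡ b i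
bits-fromBits b i =
  trans (cong (Inverse.to FinP.2↔Bool) (FinP.finToFun-funToFin (Inverse.from FinP.2↔Bool ∘ b) i))
        (Inverse.strictlyInverseˡ FinP.2↔Bool (b i))

fromBits-bits : ∀ {n} (c : Fin (2 ^ n)) → fromBits {n} (bits c) ≡ c
fromBits-bits {n} c = trans (funToFin-cong {n} (Inverse.strictlyInverseʳ FinP.2↔Bool ∘ finToFun c))
                            (FinP.funToFin-finToFin {n} {2} c)

bits-injective : ∀ {n} {c c' : Fin (2 ^ n)} → (∀ i → bits {n} c i ≡ bits c' i) → c ≡ c'
bits-injective {n} {c} {c'} bits≗ = begin
  c                             ≡⟨ fromBits-bits {n} c ⟨
  fromBits {n} (bits {n} c)     ≡⟨ funToFin-cong (cong (Inverse.from FinP.2↔Bool) ∘ bits≗) ⟩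
  fromBits {n} (bits {n} c')    ≡⟨ fromBits-bits {n} c' ⟩
  c'                            ∎
  where open ≡-Reasoning

module Realisation {X Y : Set} {k n : ℕ} {A : Matrix X Y k} {J : Fin n → Y} (sh : PShattered A n J) where

  threshold : Fin n → ℚ
  threshold = proj₁ sh

  row : (Fin n → Bool) → X
  row b = proj₁ (proj₂ sh b)

  realises : (b : Fin n → Bool) (i : Fin n) → (threshold i ≤ℚ val (A (row b) (J i))) ⇔ (b i ≡ true)
  realises b = proj₂ (proj₂ sh b)

  row-injective : ∀ {b c} → row b ≡ row c → ∀ i → b i ≡ c i
  row-injective {b} {c} rb≡rc i = ⇔-true-unique
    (subst (λ x → (threshold i ≤ℚ val (A x (J i))) ⇔ (b i ≡ true)) rb≡rc (realises b i)) (realises c i)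

  2^n≤card : ∀ {N} → Fin N ↔ X → 2 ^ n ≤ N
  2^n≤card e = injective⇒≤-via e (bits-injective ∘ row-injective)

module LevelRealisation {X : Set} {k n : ℕ} {ℓ : X → Fin k} {J : Fin n → (X → Bool)}
                        (sh : PShattered (levelMatrix ℓ) n J) where

  open Realisation {A = levelMatrix ℓ} {J} sh public

  level : (Fin n → Bool) → Fin k
  level = ℓ ∘ row

  level-mono : ∀ {b c} i → b i ≡ true → c i ≡ false → level c Fin.≤ level b
  level-mono {b} {c} i bᵢ cᵢ = entry-<⇒level-≤ {β = J i (row b)} {β' = J i (row c)} (threshold-separates
    (Equivalence.from (realises b i) bᵢ)
    (BoolP.not-¬ cᵢ ∘ Equivalence.to (realises c i)))

  level-cross : ∀ {b c} i j → b i ≡ true → c i ≡ false → c j ≡ true → b j ≡ false → level b ≡ level c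
  level-cross i j bᵢ cᵢ cⱼ bⱼ = FinP.≤-antisym (level-mono j cⱼ bⱼ) (level-mono i bᵢ cᵢ)

record LevelSquare {X : Set} {k : ℕ} (ℓ : X → Fin k) : Set where
  field
    low left right high : X
    left≢right : left ≢ right
    low≢left : low ≢ left
    low≢right : low ≢ right
    high≢left : high ≢ left
    high≢right : high ≢ right
    low≤left : ℓ low Fin.≤ ℓ left
    left≡right : ℓ left ≡ ℓ right
    left≤high : ℓ left Fin.≤ ℓ high

module AtLeastTwoColumns {X : Set} {k m : ℕ} {ℓ : X → Fin k} {J : Fin (suc (suc m)) → (X → Bool)}
                         (sh : PShattered (levelMatrix ℓ) (suc (suc m)) J) where

  open LevelRealisation {ℓ = ℓ} {J} sh

  first : Fin (suc (suc m)) → Bool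
  first 0F = true
  first (Fin.suc _) = false

  -- A mixed pattern crosses first or its complement, and these two cross each other.
  mixed-level : ∀ b j → b 0F ≢ b j → level b ≡ level first
  mixed-level b 0F b₀≢bⱼ = contradiction refl b₀≢bⱼ
  mixed-level b (Fin.suc j) b₀≢bⱼ with b 0F in b₀ | b (Fin.suc j) in bⱼ
  ... | false | true = level-cross (Fin.suc j) 0F bⱼ refl refl b₀
  ... | true | false = trans (level-cross {c = not ∘ first} 0F (Fin.suc j) b₀ refl refl bⱼ)
                             (level-cross 1F 0F refl refl refl refl)
  ... | false | false = contradiction refl b₀≢bⱼ
  ... | true | true = contradiction refl b₀≢bⱼ

  constant-or-mixed : (b : Fin (suc (suc m)) → Bool) → (∀ i → b i ≡ b 0F) ⊎ ∃ λ j → b 0F ≢ b j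
  constant-or-mixed b with FinP.all? (λ i → b i BoolP.≟ b 0F)
  ... | yes constant = inj₁ constant
  ... | no ¬constant = inj₂ (map₂ (_∘ sym) (FinP.¬∀⟶∃¬ _ _ (λ i → b i BoolP.≟ b 0F) ¬constant))

  module _ {M : ℕ} (σ : X → Fin M) (σ-separates : ∀ {x y} → ℓ x ≡ ℓ y → σ x ≡ σ y → x ≡ y) where

    summary : (Fin (suc (suc m)) → Bool) → Bool ⊎ Fin M
    summary b with constant-or-mixed b
    ... | inj₁ _ = inj₁ (b 0F)
    ... | inj₂ _ = inj₂ (σ (row b))

    summary-injective : ∀ {b c} → summary b ≡ summary c → ∀ i → b i ≡ c i
    summary-injective {b} {c} with constant-or-mixed b | constant-or-mixed c
    ... | inj₁ b-constant | inj₁ c-constant = λ b₀≡c₀ i →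
      trans (b-constant i) (trans (inj₁-injective b₀≡c₀) (sym (c-constant i)))
    ... | inj₂ (j , b-mixed) | inj₂ (j' , c-mixed) = λ σb≡σc → row-injective
      (σ-separates (trans (mixed-level b j b-mixed) (sym (mixed-level c j' c-mixed))) (inj₂-injective σb≡σc))
    ... | inj₁ _ | inj₂ _ = λ ()
    ... | inj₂ _ | inj₁ _ = λ ()

    2^n≤2+fibre : 2 ^ suc (suc m) ≤ 2 + M
    2^n≤2+fibre = injective⇒≤-via (↔-trans FinP.+↔⊎ (FinP.2↔Bool ⊎-↔ ↔-refl))
                                  (bits-injective ∘ summary-injective)

  corner : Bool → Bool → Fin (suc (suc m)) → Bool
  corner x y 0F = x
  corner x y 1F = y
  corner x y (Fin.suc (Fin.suc _)) = false

  corner-square : LevelSquare ℓ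
  corner-square = record
    { low = row (corner false false)
    ; left = row (corner true false)
    ; right = row (corner false true)
    ; high = row (corner true true)
    ; left≢right = λ eq → contradiction (row-injective eq 0F) λ ()
    ; low≢left = λ eq → contradiction (row-injective eq 0F) λ ()
    ; low≢right = λ eq → contradiction (row-injective eq 1F) λ ()
    ; high≢left = λ eq → contradiction (row-injective eq 1F) λ ()
    ; high≢right = λ eq → contradiction (row-injective eq 0F) λ ()
    ; low≤left = level-mono 0F refl refl
    ; left≡right = level-cross 0F 1F refl refl refl refl
    ; left≤high = level-mono 1F refl refl
    }

module _ {X : Set} {k : ℕ} (ℓ : X → Fin k) where

  rows-realised : ∀ {n} (J : Fin n → X) (J⁻¹ : X → Fin n) → (∀ i → J⁻¹ (J i) ≡ i) →
    (b : Fin n → Bool) (i : Fin n) →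
    (val (entry (ℓ (J i)) true) ≤ℚ val ((levelMatrix ℓ ᵀ) (b ∘ J⁻¹) (J i))) ⇔ (b i ≡ true)
  rows-realised J J⁻¹ J⁻¹∘J b i =
    subst (λ j → (val (entry (ℓ (J i)) true) ≤ℚ val (entry (ℓ (J i)) (b j))) ⇔ (b i ≡ true))
          (sym (J⁻¹∘J i)) (entry-threshold (ℓ (J i)) (b i))

  rows-PShattered : ∀ {n} (J : Fin n → X) (J⁻¹ : X → Fin n) → (∀ i → J⁻¹ (J i) ≡ i) →
    PShattered (levelMatrix ℓ ᵀ) n J
  rows-PShattered J J⁻¹ J⁻¹∘J =
    (λ i → val (entry (ℓ (J i)) true)) , λ b → b ∘ J⁻¹ , rows-realised J J⁻¹ J⁻¹∘J b

  level-rows-VShattered : ∀ {n} (J : Fin n → X) (J⁻¹ : X → Fin n) → (∀ i → J⁻¹ (J i) ≡ i) →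
    (a : Fin k) → (∀ i → ℓ (J i) ≡ a) → VShattered (levelMatrix ℓ ᵀ) n J
  level-rows-VShattered J J⁻¹ J⁻¹∘J a level≡a = val (entry a true) , λ b → b ∘ J⁻¹ , λ i →
    subst (λ j → (val (entry j true) ≤ℚ val (entry (ℓ (J i)) (b (J⁻¹ (J i))))) ⇔ (b i ≡ true))
          (level≡a i) (rows-realised J J⁻¹ J⁻¹∘J b i)

  VShattered-rows-level : ∀ {n} {J : Fin n → X} → VShattered (levelMatrix ℓ ᵀ) n J →
    ∀ i i' → ℓ (J i') Fin.≤ ℓ (J i)
  VShattered-rows-level {J = J} (t , realise) i i' =
    entry-<⇒level-≤ {β = all-true (J i)} {β' = all-false (J i')} (threshold-separates
      (Equivalence.from (proj₂ (realise (const true)) i) refl)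
      (BoolP.not-¬ refl ∘ Equivalence.to (proj₂ (realise (const false)) i')))
    where
    all-true all-false : X → Bool
    all-true = proj₁ (realise (const true))
    all-false = proj₁ (realise (const false))

  levelMatrix-Pdim* : ∀ {N} → Fin N ↔ X → Pdim*≡ (levelMatrix ℓ) N
  levelMatrix-Pdim* e =
    ( ( Inverse.to e
      , retraction⇒injective (Inverse.from e) (Inverse.strictlyInverseʳ e)
      , rows-PShattered (Inverse.to e) (Inverse.from e) (Inverse.strictlyInverseʳ e))
    , λ n J J-injective _ → injective⇒≤-via e J-injective)

2+2^d<2^1+d : ∀ {d} → 2 ≤ d → 2 + 2 ^ d < 2 ^ suc d
2+2^d<2^1+d {d} 2≤d = begin-strict
  2 + 2 ^ d          <⟨ ℕP.+-monoˡ-< (2 ^ d) (ℕP.≤-trans (ℕP.n≤1+n 3) (ℕP.^-monoʳ-≤ 2 2≤d)) ⟩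
  2 ^ d + 2 ^ d      ≡⟨ cong (_+_ (2 ^ d)) (ℕP.+-identityʳ (2 ^ d)) ⟨
  2 ^ suc d          ∎
  where open ℕP.≤-Reasoning

coordinate : ∀ {k d} → Fin d → (Fin k × Fin (2 ^ d) → Bool)
coordinate {d = d} i (_ , c) = bits {d} c i

coordinate-injective : ∀ {k d} → Injective _≡_ _≡_ (coordinate {suc k} {d})
coordinate-injective {d = d} {i} {i'} coordᵢ≡coordᵢ' =
  sym (invert (subst (Reflects (i' ≡ i)) δᵢ'≡true (proof (i' FinP.≟ i))))
  where
  δ : Fin d → Bool
  δ j = does (j FinP.≟ i)
  δᵢ≡δᵢ' : δ i ≡ δ i'
  δᵢ≡δᵢ' = begin
    δ i                          ≡⟨ bits-fromBits δ i ⟨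
    bits {d} (fromBits δ) i      ≡⟨ cong (λ column → column (0F , fromBits δ)) coordᵢ≡coordᵢ' ⟩
    bits {d} (fromBits δ) i'     ≡⟨ bits-fromBits δ i' ⟩
    δ i'                         ∎
    where open ≡-Reasoning
  δᵢ'≡true : δ i' ≡ true
  δᵢ'≡true = trans (sym δᵢ≡δᵢ') (dec-true (i FinP.≟ i) refl)

coordinates-PShattered : ∀ {k d} → PShattered (levelMatrix {Fin (suc k) × Fin (2 ^ d)} proj₁) d coordinate
coordinates-PShattered {k} = const (val (entry {suc k} 0F true)) , λ b → (0F , fromBits b) , λ i →
  subst (λ β → (val (entry {suc k} 0F true) ≤ℚ val (entry 0F β)) ⇔ (b i ≡ true))
        (sym (bits-fromBits b i)) (entry-threshold 0F (b i))

cube-shattered≤ : ∀ {k d} → 2 ≤ d → ∀ n {J} → PShattered (levelMatrix {Fin k × Fin (2 ^ d)} proj₁) n J → n ≤ d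
cube-shattered≤ 2≤d zero _ = z≤n
cube-shattered≤ 2≤d (suc zero) _ = ℕP.≤-trans (s≤s z≤n) 2≤d
cube-shattered≤ {d = d} 2≤d (suc (suc m)) {J} sh with suc (suc m) ℕP.≤? d
... | yes n≤d = n≤d
... | no n≰d = contradiction
  (ℕP.≤-trans (ℕP.^-monoʳ-≤ 2 (ℕP.≰⇒> n≰d))
              (AtLeastTwoColumns.2^n≤2+fibre {ℓ = proj₁} {J} sh proj₂ λ a≡a' c≡c' → ×-≡,≡→≡ (a≡a' , c≡c')))
  (ℕP.<⇒≱ (2+2^d<2^1+d 2≤d))

cube-Pdim : ∀ {k d} → 2 ≤ d → Pdim≡ (levelMatrix {Fin (suc k) × Fin (2 ^ d)} proj₁) d
cube-Pdim 2≤d =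
  (coordinate , coordinate-injective , coordinates-PShattered) , λ n J _ → cube-shattered≤ 2≤d n {J}

cube-Vdim* : ∀ {k d} → Vdim*≡ (levelMatrix {Fin (suc k) × Fin (2 ^ d)} proj₁) (2 ^ d)
cube-Vdim* =
  ((0F ,_) , ,-injectiveʳ , level-rows-VShattered proj₁ (0F ,_) proj₂ (λ _ → refl) 0F (λ _ → refl)) ,
  λ n J J-injective sh → FinP.injective⇒≤ {f = proj₂ ∘ J} λ cᵢ≡cᵢ' → J-injective (×-≡,≡→≡
    (FinP.≤-antisym (VShattered-rows-level proj₁ sh _ _) (VShattered-rows-level proj₁ sh _ _) , cᵢ≡cᵢ'))

endsLevel : ∀ {k} → Fin (suc k) ⊎ Fin 2 → Fin (suc k)
endsLevel (inj₁ j) = j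
endsLevel (inj₂ 0F) = 0F
endsLevel (inj₂ 1F) = fromℕ _

shared-level-is-end : ∀ {k} {x y : Fin (suc k) ⊎ Fin 2} → x ≢ y → endsLevel x ≡ endsLevel y →
  endsLevel x ≡ 0F ⊎ endsLevel x ≡ fromℕ k
shared-level-is-end {x = inj₁ i} {inj₁ j} x≢y i≡j = contradiction (cong inj₁ i≡j) x≢y
shared-level-is-end {x = inj₁ i} {inj₂ 0F} _ i≡0 = inj₁ i≡0
shared-level-is-end {x = inj₁ i} {inj₂ 1F} _ i≡top = inj₂ i≡top
shared-level-is-end {x = inj₂ 0F} _ _ = inj₁ refl
shared-level-is-end {x = inj₂ 1F} _ _ = inj₂ refl

bottom-fibre : ∀ {k} {x : Fin (suc (suc k)) ⊎ Fin 2} → endsLevel x ≡ 0F → x ≡ inj₁ 0F ⊎ x ≡ inj₂ 0F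
bottom-fibre {x = inj₁ j} j≡0 = inj₁ (cong inj₁ j≡0)
bottom-fibre {x = inj₂ 0F} _ = inj₂ refl
bottom-fibre {x = inj₂ 1F} ()

top-fibre : ∀ {k} {x : Fin (suc (suc k)) ⊎ Fin 2} → endsLevel x ≡ fromℕ (suc k) →
  x ≡ inj₁ (fromℕ (suc k)) ⊎ x ≡ inj₂ 1F
top-fibre {x = inj₁ j} j≡top = inj₁ (cong inj₁ j≡top)
top-fibre {x = inj₂ 0F} ()
top-fibre {x = inj₂ 1F} _ = inj₂ refl

no-three-in-pair : ∀ {A : Set} {u v x y z : A} → x ≡ u ⊎ x ≡ v → y ≡ u ⊎ y ≡ v → z ≡ u ⊎ z ≡ v →
  x ≢ y → x ≢ z → y ≢ z → ⊥
no-three-in-pair (inj₁ refl) (inj₁ refl) _ x≢y _ _ = x≢y refl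
no-three-in-pair (inj₂ refl) (inj₂ refl) _ x≢y _ _ = x≢y refl
no-three-in-pair (inj₁ refl) (inj₂ refl) (inj₁ refl) _ x≢z _ = x≢z refl
no-three-in-pair (inj₁ refl) (inj₂ refl) (inj₂ refl) _ _ y≢z = y≢z refl
no-three-in-pair (inj₂ refl) (inj₁ refl) (inj₁ refl) _ _ y≢z = y≢z refl
no-three-in-pair (inj₂ refl) (inj₁ refl) (inj₂ refl) _ x≢z _ = x≢z refl

ends-no-square : ∀ {k} → ¬ LevelSquare (endsLevel {suc k})
ends-no-square {k} square = [ three-at-bottom , three-at-top ]′ (shared-level-is-end left≢right left≡right)
  where
  open LevelSquare square
  three-at-bottom : endsLevel left ≡ 0F → ⊥
  three-at-bottom left-bottom =
    no-three-in-pair (bottom-fibre low-bottom) (bottom-fibre left-bottom)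
                     (bottom-fibre (trans (sym left≡right) left-bottom)) low≢left low≢right left≢right
    where
    low-bottom : endsLevel low ≡ 0F
    low-bottom = FinP.toℕ-injective (ℕP.n≤0⇒n≡0 (subst (λ j → endsLevel low Fin.≤ j) left-bottom low≤left))
  three-at-top : endsLevel left ≡ fromℕ (suc k) → ⊥
  three-at-top left-top =
    no-three-in-pair (top-fibre high-top) (top-fibre left-top)
                     (top-fibre (trans (sym left≡right) left-top)) high≢left high≢right left≢right
    where
    high-top : endsLevel high ≡ fromℕ (suc k)
    high-top = FinP.≤-antisym (FinP.≤fromℕ _) (subst (Fin._≤ endsLevel high) left-top left≤high)

ends-shattered≤1 : ∀ {k} n {J} → PShattered (levelMatrix (endsLevel {k})) n J → n ≤ 1
ends-shattered≤1 zero _ = z≤n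
ends-shattered≤1 (suc zero) _ = ℕP.≤-refl
ends-shattered≤1 {zero} (suc (suc m)) {J} sh = contradiction
  (ℕP.≤-trans (ℕP.^-monoʳ-≤ 2 (s≤s (s≤s (z≤n {m}))))
              (Realisation.2^n≤card {A = levelMatrix endsLevel} {J} sh FinP.+↔⊎))
  (ℕP.<⇒≱ (ℕP.n<1+n 3))
ends-shattered≤1 {suc k} (suc (suc m)) {J} sh =
  ⊥-elim (ends-no-square (AtLeastTwoColumns.corner-square {ℓ = endsLevel} {J} sh))

isExtra : ∀ {k} → Fin k ⊎ Fin 2 → Bool
isExtra (inj₁ _) = false
isExtra (inj₂ _) = true

lowest-row : ∀ {k} → Bool → Fin (suc k) ⊎ Fin 2
lowest-row true = inj₂ 0F
lowest-row false = inj₁ 0F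

isExtra-VShattered : ∀ {k} → VShattered (levelMatrix (endsLevel {k})) 1 (const isExtra)
isExtra-VShattered {k} = val (entry {suc k} 0F true) , λ b → lowest-row (b 0F) , λ { 0F → realised (b 0F) }
  where
  realised : ∀ β →
    (val (entry {suc k} 0F true) ≤ℚ val (levelMatrix endsLevel (lowest-row β) isExtra)) ⇔ (β ≡ true)
  realised true = entry-threshold {suc k} 0F true
  realised false = entry-threshold {suc k} 0F false

ends-Vdim : ∀ {k} → Vdim≡ (levelMatrix (endsLevel {k})) 1
ends-Vdim = (const isExtra , (λ { {0F} {0F} _ → refl }) , isExtra-VShattered) ,
            λ n J _ → ends-shattered≤1 n {J} ∘ V⇒P {A = levelMatrix endsLevel} {J}

ends-Pdim : ∀ {k} → Pdim≡ (levelMatrix (endsLevel {k})) 1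
ends-Pdim = (const isExtra , (λ { {0F} {0F} _ → refl }) ,
             V⇒P {A = levelMatrix endsLevel} {J = const isExtra} isExtra-VShattered) ,
            λ n J _ → ends-shattered≤1 n {J}

theorem7 :
    ((d k : ℕ) → 2 ≤ d → 1 ≤ k →
      Σ Set λ X → Σ Set λ Y → Σ (Matrix X Y k) λ A →
        Pdim≡ A d × Vdim*≡ A (2 ^ d) × Pdim*≡ A (k * 2 ^ d))
    ×
    ((k : ℕ) → 1 ≤ k →
      Σ Set λ X → Σ Set λ Y → Σ (Matrix X Y k) λ A →
        Vdim≡ A 1 × Pdim≡ A 1 × Pdim*≡ A (k + 2))
theorem7 =
  (λ { d (suc k) 2≤d _ → _ , _ , levelMatrix {Fin (suc k) × Fin (2 ^ d)} proj₁ ,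
         cube-Pdim 2≤d , cube-Vdim* {d = d} , levelMatrix-Pdim* proj₁ FinP.*↔× }) ,
  (λ { (suc k) _ → _ , _ , levelMatrix endsLevel ,
         ends-Vdim , ends-Pdim , levelMatrix-Pdim* endsLevel FinP.+↔⊎ })
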